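{- Let $n\ge1$ and let $X,Y$ be $3$-element subsets of $\mathbb{Z}/n\mathbb{Z}$ with $\Delta(X)=\Delta(Y)$ as multisets. Then $X$ and $Y$ are affinely equivalent, i.e. there exist $u,v\in\mathbb{Z}/n\mathbb{Z}$ with $u$ a unit such that $Y=uX+v$.
   Context: For a set $X=\{x_1,\dots,x_k\}$ of $k$ residues mod $n$, $\Delta(X)$ denotes the multiset of the $k^2$ residues $x_i-x_j$, $1\le i,j\le k$. -}

module Defs where

open import Data.Nat using (ℕ; _+_; _*_; _∸_; NonZero)
open import Data.Nat.DivMod using (_mod_)
open import Data.Fin using (Fin; toℕ)
open import Data.List using (List; _∷_; []; map; concatMap)

-- Residues mod n are represented by Fin n (canonical representatives 0..n-1),
-- with arithmetic done in ℕ and reduced mod n.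
ℤ/ : ℕ → Set
ℤ/ n = Fin n

module _ {n : ℕ} .{{_ : NonZero n}} where

  infixl 6 _+ₘ_ _-ₘ_
  infixl 7 _*ₘ_

  _+ₘ_ : Fin n → Fin n → Fin n
  a +ₘ b = (toℕ a + toℕ b) mod n

  -- a - b ≡ a + (n - b) (mod n)
  _-ₘ_ : Fin n → Fin n → Fin n
  a -ₘ b = (toℕ a + (n ∸ toℕ b)) mod n

  _*ₘ_ : Fin n → Fin n → Fin n
  a *ₘ b = (toℕ a * toℕ b) mod n

  oneₘ : Fin n
  oneₘ = 1 mod n

  -- Δ(X): the multiset (as a list, compared up to permutation) of all k² differences x_i - x_j
  Δ : List (Fin n) → List (Fin n)
  Δ xs = concatMap (λ x → map (λ y → x -ₘ y) xs) xs

-- Residues are compared through their canonical representatives in ℤ: an equation in ℤ/nℤ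
-- is a congruence mod n, so every algebraic step becomes a ring identity in ℤ.
--
-- Since y₁ ≠ y₂, the difference y₂ - y₁ is an off-diagonal element x_j - x_i of Δ(X);
-- relabelling X we may assume y₂ - y₁ = x₂ - x₁. Cancelling the three zeros and
-- ±(x₂ - x₁) from Δ(X) = Δ(Y) leaves {±(x₁ - x₃), ±(x₂ - x₃)} = {±(y₁ - y₃), ±(y₂ - y₃)}.
-- Locating y₃ - y₁ on the left, and in two of the four cases also y₃ - y₂, produces an
-- anchor a ↦ p and a sign ε = ±1 with y - p = ε (x - a) for corresponding points,
-- i.e. Y = εX + (p - εa).
module Submission where

open import Defs
open import Data.Empty using (⊥-elim)
open import Data.Fin using (Fin; toℕ; fromℕ<)
open import Data.Fin.Properties using (toℕ-fromℕ<; toℕ≤n; toℕ<n; toℕ-injective)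
open import Data.Integer
  using (ℤ; ∣_∣; +_; _+_; _-_; _*_; -_; 0ℤ; 1ℤ; -1ℤ; _◃_)
open import Data.Integer.DivMod using (_%ℕ_; _/ℕ_; n%ℕd<d; a≡a%ℕn+[a/ℕn]*n)
open import Data.Integer.Divisibility.Signed
  using (_∣_; divides; ∣⇒∣ᵤ; ∣m∣n⇒∣m+n; ∣m⇒∣-m; ∣n⇒∣m*n; ∣m⇒∣m*n)
open import Data.Integer.Properties
  using (+-identityʳ; +-inverseʳ; *-identityˡ; neg-involutive; pos-*; +-injective;
         i-j≡0⇒i≡j; ∣i∣≡0⇒i≡0; m-n≡m⊖n; ∣m⊝n∣≤m⊔n)
open import Data.Integer.Tactic.RingSolver using (solve; solve-∀)
open import Data.List using (List; _∷_; []; map; _++_; concatMap)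
open import Data.List.Membership.Propositional using (_∈_)
open import Data.List.Relation.Binary.Pointwise using (Pointwise)
import Data.List.Relation.Binary.Permutation.Propositional as ↭
open import Data.List.Relation.Binary.Permutation.Propositional
  using (_↭_; module PermutationReasoning; ↭-reflexive; ↭-refl; ↭-sym; ↭-trans; prep; swap)
open import Data.List.Relation.Binary.Permutation.Propositional.Properties
  using (map⁺; ∈-resp-↭; ↭-reverse; ++⁺; ++⁺ˡ; ++⁺ʳ; ++-comm; shift; shifts; drop-∷)
open import Data.List.Relation.Unary.Any using (here; there)
open import Data.Nat as ℕ using (ℕ; NonZero; _∸_)
open import Data.Nat.DivMod using (m<n⇒m%n≡m)
open import Data.Nat.Divisibility using (n∣m⇒m%n≡0)
open import Data.Nat.Properties using (m∸n+n≡m; ≤-<-trans; ⊔-lub)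
open import Data.Product using (Σ; _×_; _,_)
open import Data.Sign as Sign using (Sign)
open import Function.Base using (_∋_)
open import Level using (0ℓ)
open import Relation.Binary.Bundles using (Setoid)
import Relation.Binary.Reasoning.Setoid as SetoidReasoning
open import Relation.Binary.PropositionalEquality
  using (_≡_; _≢_; refl; sym; trans; cong; cong₂; subst; module ≡-Reasoning)

private variable A B : Set

++-cancelˡ : ∀ (xs : List A) {ys zs} → xs ++ ys ↭ xs ++ zs → ys ↭ zs
++-cancelˡ []       ys↭zs = ys↭zs
++-cancelˡ (x ∷ xs) p     = ++-cancelˡ xs (drop-∷ p)

++-cancel-↭ : ∀ {ws xs ys zs : List A} → ws ↭ xs → ws ++ ys ↭ xs ++ zs → ys ↭ zs
++-cancel-↭ {ws = ws} {zs = zs} ws↭xs p = ++-cancelˡ ws (↭-trans p (++⁺ʳ zs (↭-sym ws↭xs)))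

concatMap⁺ : ∀ (f : A → List B) {xs ys} → xs ↭ ys → concatMap f xs ↭ concatMap f ys
concatMap⁺ f ↭.refl        = ↭-refl
concatMap⁺ f (prep x p)    = ++⁺ˡ (f x) (concatMap⁺ f p)
concatMap⁺ f (swap x y p)  = ↭-trans (shifts (f x) (f y)) (++⁺ˡ (f y) (++⁺ˡ (f x) (concatMap⁺ f p)))
concatMap⁺ f (↭.trans p q) = ↭-trans (concatMap⁺ f p) (concatMap⁺ f q)

concatMap-cong : ∀ {f g : A → List B} → (∀ x → f x ↭ g x) → ∀ xs → concatMap f xs ↭ concatMap g xs
concatMap-cong f↭g []       = ↭-refl
concatMap-cong f↭g (x ∷ xs) = ++⁺ (f↭g x) (concatMap-cong f↭g xs)

module Congruence (n : ℕ) where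

  -- A record rather than a synonym for + n ∣ i - j, so that i and j can be inferred.
  infix 4 _≈_
  record _≈_ (i j : ℤ) : Set where
    constructor congruent
    field n∣i-j : + n ∣ i - j

  ≈-reflexive : ∀ {i j} → i ≡ j → i ≈ j
  ≈-reflexive {i} refl = congruent (divides 0ℤ (solve (i ∷ [])))

  ≈-refl : ∀ {i} → i ≈ i
  ≈-refl = ≈-reflexive refl

  ≈-sym : ∀ {i j} → i ≈ j → j ≈ i
  ≈-sym {i} {j} (congruent p) =
    congruent (subst (+ n ∣_) ((- (i - j) ≡ j - i) ∋ solve (i ∷ j ∷ [])) (∣m⇒∣-m p))

  ≈-trans : ∀ {i j k} → i ≈ j → j ≈ k → i ≈ k
  ≈-trans {i} {j} {k} (congruent p) (congruent q) =
    congruent (subst (+ n ∣_) ((i - j + (j - k) ≡ i - k) ∋ solve (i ∷ j ∷ k ∷ [])) (∣m∣n⇒∣m+n p q))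

  +-cong : ∀ {i j k l} → i ≈ j → k ≈ l → i + k ≈ j + l
  +-cong {i} {j} {k} {l} (congruent p) (congruent q) =
    congruent (subst (+ n ∣_) ((i - j + (k - l) ≡ i + k - (j + l)) ∋ solve (i ∷ j ∷ k ∷ l ∷ []))
      (∣m∣n⇒∣m+n p q))

  +-congˡ : ∀ i {j k} → j ≈ k → i + j ≈ i + k
  +-congˡ i = +-cong (≈-refl {i})

  -‿cong : ∀ {i j} → i ≈ j → - i ≈ - j
  -‿cong {i} {j} (congruent p) =
    congruent (subst (+ n ∣_) ((- (i - j) ≡ - i - - j) ∋ solve (i ∷ j ∷ [])) (∣m⇒∣-m p))

  *-cong : ∀ {i j k l} → i ≈ j → k ≈ l → i * k ≈ j * l
  *-cong {i} {j} {k} {l} (congruent p) (congruent q) =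
    congruent (subst (+ n ∣_) (((i - j) * k + j * (k - l) ≡ i * k - j * l) ∋ solve (i ∷ j ∷ k ∷ l ∷ []))
      (∣m∣n⇒∣m+n (∣m⇒∣m*n k p) (∣n⇒∣m*n j q)))

  i-j≈0⇒i≈j : ∀ {i j} → i - j ≈ 0ℤ → i ≈ j
  i-j≈0⇒i≈j {i} {j} (congruent p) = congruent (subst (+ n ∣_) (+-identityʳ (i - j)) p)

  setoid : Setoid 0ℓ 0ℓ
  setoid = record
    { _≈_           = _≈_
    ; isEquivalence = record { refl = ≈-refl ; sym = ≈-sym ; trans = ≈-trans }
    }

  module ≈-Reasoning = SetoidReasoning setoid

module _ {n : ℕ} .{{_ : NonZero n}} where

  open Congruence n

  ⟦_⟧ : Fin n → ℤ
  ⟦ a ⟧ = + toℕ a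

  residue : ℤ → Fin n
  residue i = fromℕ< (n%ℕd<d i n)

  ⟦residue⟧ : ∀ i → ⟦ residue i ⟧ ≈ i
  ⟦residue⟧ i = congruent (divides (- q) (begin
    ⟦ residue i ⟧ - i      ≡⟨ cong (λ t → + t - i) (toℕ-fromℕ< _) ⟩
    + r - i                ≡⟨ cong (λ t → + r - t) (a≡a%ℕn+[a/ℕn]*n i n) ⟩
    + r - (+ r + q * + n)  ≡⟨ r-[r+qm]≡-q*m (+ r) q (+ n) ⟩
    - q * + n              ∎))
    where
    open ≡-Reasoning
    r = i %ℕ n
    q = i /ℕ n
    r-[r+qm]≡-q*m : ∀ r q m → r - (r + q * m) ≡ - q * m
    r-[r+qm]≡-q*m = solve-∀

  ⟦⟧-injective : ∀ {a b} → ⟦ a ⟧ ≈ ⟦ b ⟧ → a ≡ b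
  ⟦⟧-injective {a} {b} (congruent n∣a-b) =
    toℕ-injective (+-injective (i-j≡0⇒i≡j ⟦ a ⟧ ⟦ b ⟧ (∣i∣≡0⇒i≡0 ∣a-b∣≡0)))
    where
    ∣a-b∣<n : ∣ ⟦ a ⟧ - ⟦ b ⟧ ∣ ℕ.< n
    ∣a-b∣<n = subst (ℕ._< n) (cong ∣_∣ (sym (m-n≡m⊖n (toℕ a) (toℕ b))))
                (≤-<-trans (∣m⊝n∣≤m⊔n (toℕ a) (toℕ b)) (⊔-lub (toℕ<n a) (toℕ<n b)))
    ∣a-b∣≡0 : ∣ ⟦ a ⟧ - ⟦ b ⟧ ∣ ≡ 0
    ∣a-b∣≡0 = trans (sym (m<n⇒m%n≡m ∣a-b∣<n)) (n∣m⇒m%n≡0 _ n (∣⇒∣ᵤ n∣a-b))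

  ⟦+ₘ⟧ : ∀ a b → ⟦ a +ₘ b ⟧ ≈ ⟦ a ⟧ + ⟦ b ⟧
  ⟦+ₘ⟧ a b = ⟦residue⟧ (⟦ a ⟧ + ⟦ b ⟧)

  ⟦*ₘ⟧ : ∀ a b → ⟦ a *ₘ b ⟧ ≈ ⟦ a ⟧ * ⟦ b ⟧
  ⟦*ₘ⟧ a b = ≈-trans (⟦residue⟧ (+ (toℕ a ℕ.* toℕ b))) (≈-reflexive (pos-* (toℕ a) (toℕ b)))

  ⟦-ₘ⟧ : ∀ a b → ⟦ a -ₘ b ⟧ ≈ ⟦ a ⟧ - ⟦ b ⟧
  ⟦-ₘ⟧ a b = ≈-trans (⟦residue⟧ (⟦ a ⟧ + + (n ∸ toℕ b))) (+-congˡ ⟦ a ⟧ n∸b≈-b)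
    where
    n∸b≈-b : + (n ∸ toℕ b) ≈ - ⟦ b ⟧
    n∸b≈-b = congruent (divides 1ℤ (begin
      + (n ∸ toℕ b) - - ⟦ b ⟧  ≡⟨ cong (λ t → + (n ∸ toℕ b) + t) (neg-involutive ⟦ b ⟧) ⟩
      + (n ∸ toℕ b ℕ.+ toℕ b)  ≡⟨ cong +_ (m∸n+n≡m (toℕ≤n b)) ⟩
      + n                      ≡⟨ *-identityˡ (+ n) ⟨
      1ℤ * + n                 ∎))
      where open ≡-Reasoning

  -ₘ≡-ₘ⇒≈ : ∀ a b c d → a -ₘ b ≡ c -ₘ d → ⟦ a ⟧ - ⟦ b ⟧ ≈ ⟦ c ⟧ - ⟦ d ⟧
  -ₘ≡-ₘ⇒≈ a b c d a-b≡c-d = begin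
    ⟦ a ⟧ - ⟦ b ⟧  ≈⟨ ⟦-ₘ⟧ a b ⟨
    ⟦ a -ₘ b ⟧     ≡⟨ cong ⟦_⟧ a-b≡c-d ⟩
    ⟦ c -ₘ d ⟧     ≈⟨ ⟦-ₘ⟧ c d ⟩
    ⟦ c ⟧ - ⟦ d ⟧  ∎
    where open ≈-Reasoning

  ≈⇒-ₘ≡-ₘ : ∀ a b c d → ⟦ a ⟧ - ⟦ b ⟧ ≈ ⟦ c ⟧ - ⟦ d ⟧ → a -ₘ b ≡ c -ₘ d
  ≈⇒-ₘ≡-ₘ a b c d a-b≈c-d = ⟦⟧-injective (begin
    ⟦ a -ₘ b ⟧     ≈⟨ ⟦-ₘ⟧ a b ⟩
    ⟦ a ⟧ - ⟦ b ⟧  ≈⟨ a-b≈c-d ⟩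
    ⟦ c ⟧ - ⟦ d ⟧  ≈⟨ ⟦-ₘ⟧ c d ⟨
    ⟦ c -ₘ d ⟧     ∎)
    where open ≈-Reasoning

  x-ₘx≡y-ₘy : ∀ x y → x -ₘ x ≡ y -ₘ y
  x-ₘx≡y-ₘy x y = ≈⇒-ₘ≡-ₘ x x y y (≈-reflexive (trans (+-inverseʳ ⟦ x ⟧) (sym (+-inverseʳ ⟦ y ⟧))))

  x-ₘy≡z-ₘz⇒x≡y : ∀ x y z → x -ₘ y ≡ z -ₘ z → x ≡ y
  x-ₘy≡z-ₘz⇒x≡y x y z x-y≡z-z = ⟦⟧-injective (i-j≈0⇒i≈j (begin
    ⟦ x ⟧ - ⟦ y ⟧  ≈⟨ -ₘ≡-ₘ⇒≈ x y z z x-y≡z-z ⟩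
    ⟦ z ⟧ - ⟦ z ⟧  ≡⟨ +-inverseʳ ⟦ z ⟧ ⟩
    0ℤ             ∎))
    where open ≈-Reasoning

  -ₘ-swap : ∀ a b c d → a -ₘ b ≡ c -ₘ d → b -ₘ a ≡ d -ₘ c
  -ₘ-swap a b c d a-b≡c-d = ≈⇒-ₘ≡-ₘ b a d c (begin
    ⟦ b ⟧ - ⟦ a ⟧      ≡⟨ neg-minus ⟦ a ⟧ ⟦ b ⟧ ⟨
    - (⟦ a ⟧ - ⟦ b ⟧)  ≈⟨ -‿cong (-ₘ≡-ₘ⇒≈ a b c d a-b≡c-d) ⟩
    - (⟦ c ⟧ - ⟦ d ⟧)  ≡⟨ neg-minus ⟦ c ⟧ ⟦ d ⟧ ⟩
    ⟦ d ⟧ - ⟦ c ⟧      ∎)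
    where
    open ≈-Reasoning
    neg-minus : ∀ i j → - (i - j) ≡ j - i
    neg-minus = solve-∀

  self-inverse : ∀ {u} ε → ⟦ u ⟧ ≈ ε → ε * ε ≡ 1ℤ → u *ₘ u ≡ oneₘ
  self-inverse {u} ε u≈ε ε²≡1 = ⟦⟧-injective (begin
    ⟦ u *ₘ u ⟧     ≈⟨ ⟦*ₘ⟧ u u ⟩
    ⟦ u ⟧ * ⟦ u ⟧  ≈⟨ *-cong u≈ε u≈ε ⟩
    ε * ε          ≡⟨ ε²≡1 ⟩
    1ℤ             ≈⟨ ⟦residue⟧ 1ℤ ⟨
    ⟦ oneₘ ⟧       ∎)
    where open ≈-Reasoning

  affine-point : ∀ {u} ε → ⟦ u ⟧ ≈ ε → ∀ a p x y →
                 ⟦ y ⟧ - ⟦ p ⟧ ≈ ε * (⟦ x ⟧ - ⟦ a ⟧) → u *ₘ x +ₘ (p -ₘ u *ₘ a) ≡ y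
  affine-point {u} ε u≈ε a p x y y-p≈ε[x-a] = ⟦⟧-injective (begin
    ⟦ u *ₘ x +ₘ (p -ₘ u *ₘ a) ⟧              ≈⟨ ⟦+ₘ⟧ (u *ₘ x) (p -ₘ u *ₘ a) ⟩
    ⟦ u *ₘ x ⟧ + ⟦ p -ₘ u *ₘ a ⟧             ≈⟨ +-cong (⟦*ₘ⟧ u x) ⟦p-ₘua⟧ ⟩
    ⟦ u ⟧ * ⟦ x ⟧ + (⟦ p ⟧ - ⟦ u ⟧ * ⟦ a ⟧)  ≡⟨ regroup ⟦ u ⟧ ⟦ x ⟧ ⟦ p ⟧ ⟦ a ⟧ ⟩
    ⟦ p ⟧ + ⟦ u ⟧ * (⟦ x ⟧ - ⟦ a ⟧)          ≈⟨ +-congˡ ⟦ p ⟧ (*-cong u≈ε (≈-refl {⟦ x ⟧ - ⟦ a ⟧})) ⟩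
    ⟦ p ⟧ + ε * (⟦ x ⟧ - ⟦ a ⟧)              ≈⟨ +-congˡ ⟦ p ⟧ y-p≈ε[x-a] ⟨
    ⟦ p ⟧ + (⟦ y ⟧ - ⟦ p ⟧)                  ≡⟨ cancel ⟦ p ⟧ ⟦ y ⟧ ⟩
    ⟦ y ⟧                                    ∎)
    where
    open ≈-Reasoning
    ⟦p-ₘua⟧ : ⟦ p -ₘ u *ₘ a ⟧ ≈ ⟦ p ⟧ - ⟦ u ⟧ * ⟦ a ⟧
    ⟦p-ₘua⟧ = ≈-trans (⟦-ₘ⟧ p (u *ₘ a)) (+-congˡ ⟦ p ⟧ (-‿cong (⟦*ₘ⟧ u a)))
    regroup : ∀ e x p a → e * x + (p - e * a) ≡ p + e * (x - a)
    regroup = solve-∀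
    cancel : ∀ p y → p + (y - p) ≡ y
    cancel = solve-∀

  signedDiff : Sign → Fin n → Fin n → Fin n
  signedDiff Sign.+ x a = x -ₘ a
  signedDiff Sign.- x a = a -ₘ x

  ⟦signedDiff⟧ : ∀ s x a → ⟦ signedDiff s x a ⟧ ≈ (s ◃ 1) * (⟦ x ⟧ - ⟦ a ⟧)
  ⟦signedDiff⟧ Sign.+ x a = ≈-trans (⟦-ₘ⟧ x a) (≈-reflexive (sym (*-identityˡ (⟦ x ⟧ - ⟦ a ⟧))))
  ⟦signedDiff⟧ Sign.- x a = ≈-trans (⟦-ₘ⟧ a x) (≈-reflexive (a-x≡-1*[x-a] ⟦ x ⟧ ⟦ a ⟧))
    where
    a-x≡-1*[x-a] : ∀ x a → a - x ≡ -1ℤ * (x - a)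
    a-x≡-1*[x-a] = solve-∀

  IsUnit : Fin n → Set
  IsUnit u = Σ (Fin n) λ w → u *ₘ w ≡ oneₘ

  slope : Sign → Fin n
  slope s = residue (s ◃ 1)

  slope-isUnit : ∀ s → IsUnit (slope s)
  slope-isUnit s = slope s , self-inverse (s ◃ 1) (⟦residue⟧ (s ◃ 1)) (sign² s)
    where
    sign² : ∀ s → (s ◃ 1) * (s ◃ 1) ≡ 1ℤ
    sign² Sign.+ = refl
    sign² Sign.- = refl

  AffineImage : List (Fin n) → List (Fin n) → Set
  AffineImage xs ys = Σ (Fin n) λ u → Σ (Fin n) λ v → IsUnit u × map (λ x → u *ₘ x +ₘ v) xs ↭ ys

  AffineImage-resp-↭ : ∀ {xs xs′ ys ys′} → xs ↭ xs′ → ys ↭ ys′ → AffineImage xs ys → AffineImage xs′ ys′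
  AffineImage-resp-↭ xs↭xs′ ys↭ys′ (u , v , u-isUnit , fxs↭ys) =
    u , v , u-isUnit , ↭-trans (↭-sym (map⁺ _ xs↭xs′)) (↭-trans fxs↭ys ys↭ys′)

  -- Pointwise's constructors are opened only here: overloading [] and _∷_ stalls the
  -- ring-solver macro, which is given its variables as a list.
  open Data.List.Relation.Binary.Pointwise using ([]; _∷_)

  affine-image : ∀ s a p {xs ys} → Pointwise (λ x y → y -ₘ p ≡ signedDiff s x a) xs ys → AffineImage xs ys
  affine-image s a p rel = slope s , p -ₘ slope s *ₘ a , slope-isUnit s , ↭-reflexive (map-≡ rel)
    where
    map-≡ : ∀ {xs ys} → Pointwise (λ x y → y -ₘ p ≡ signedDiff s x a) xs ys →
            map (λ x → slope s *ₘ x +ₘ (p -ₘ slope s *ₘ a)) xs ≡ ys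
    map-≡ [] = refl
    map-≡ {x ∷ _} {y ∷ _} (y-p≡signedDiff ∷ rel) =
      cong₂ _∷_ (affine-point (s ◃ 1) (⟦residue⟧ (s ◃ 1)) a p x y (begin
                   ⟦ y ⟧ - ⟦ p ⟧                ≈⟨ ⟦-ₘ⟧ y p ⟨
                   ⟦ y -ₘ p ⟧                   ≡⟨ cong ⟦_⟧ y-p≡signedDiff ⟩
                   ⟦ signedDiff s x a ⟧         ≈⟨ ⟦signedDiff⟧ s x a ⟩
                   (s ◃ 1) * (⟦ x ⟧ - ⟦ a ⟧)   ∎))
                (map-≡ rel)
      where open ≈-Reasoning

  Δ⁺ : ∀ {xs ys} → xs ↭ ys → Δ xs ↭ Δ ys
  Δ⁺ {xs} xs↭ys = ↭-trans (concatMap-cong (λ x → map⁺ (x -ₘ_) xs↭ys) xs) (concatMap⁺ _ xs↭ys)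

  diagonal : Fin n → Fin n → Fin n → List (Fin n)
  diagonal a b c = a -ₘ a ∷ b -ₘ b ∷ c -ₘ c ∷ []

  side : Fin n → Fin n → List (Fin n)
  side a b = a -ₘ b ∷ b -ₘ a ∷ []

  Δ-triangle : ∀ a b c → Δ (a ∷ b ∷ c ∷ []) ↭ diagonal a b c ++ side a b ++ side a c ++ side b c
  Δ-triangle a b c = begin
    aa ∷ ab ∷ ac ∷ ba ∷ bb ∷ bc ∷ ca ∷ cb ∷ cc ∷ []
      ↭⟨ prep aa (shift bb (ab ∷ ac ∷ ba ∷ []) _) ⟩
    aa ∷ bb ∷ ab ∷ ac ∷ ba ∷ bc ∷ ca ∷ cb ∷ cc ∷ []
      ↭⟨ prep aa (prep bb (shift cc (ab ∷ ac ∷ ba ∷ bc ∷ ca ∷ cb ∷ []) [])) ⟩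
    aa ∷ bb ∷ cc ∷ ab ∷ ac ∷ ba ∷ bc ∷ ca ∷ cb ∷ []
      ↭⟨ prep aa (prep bb (prep cc (prep ab (swap ac ba (swap bc ca ↭-refl))))) ⟩
    aa ∷ bb ∷ cc ∷ ab ∷ ba ∷ ac ∷ ca ∷ bc ∷ cb ∷ []  ∎
    where
    open PermutationReasoning
    aa = a -ₘ a; ab = a -ₘ b; ac = a -ₘ c
    ba = b -ₘ a; bb = b -ₘ b; bc = b -ₘ c
    ca = c -ₘ a; cb = c -ₘ b; cc = c -ₘ c

  diagonal-constant : ∀ a b c a′ b′ c′ → diagonal a b c ≡ diagonal a′ b′ c′
  diagonal-constant a b c a′ b′ c′ =
    cong₂ _∷_ (x-ₘx≡y-ₘy a a′) (cong₂ _∷_ (x-ₘx≡y-ₘy b b′) (cong (_∷ []) (x-ₘx≡y-ₘy c c′)))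

  side-cong : ∀ a b c d → b -ₘ a ≡ d -ₘ c → side a b ≡ side c d
  side-cong a b c d b-a≡d-c = cong₂ (λ s t → s ∷ t ∷ []) (-ₘ-swap b a d c b-a≡d-c) b-a≡d-c

  remaining-sides : ∀ x₁ x₂ x₃ y₁ y₂ y₃ → y₂ -ₘ y₁ ≡ x₂ -ₘ x₁ →
                    Δ (x₁ ∷ x₂ ∷ x₃ ∷ []) ↭ Δ (y₁ ∷ y₂ ∷ y₃ ∷ []) →
                    side x₁ x₃ ++ side x₂ x₃ ↭ side y₁ y₃ ++ side y₂ y₃
  remaining-sides x₁ x₂ x₃ y₁ y₂ y₃ y₂-y₁≡x₂-x₁ ΔX↭ΔY =
    ++-cancelˡ (diagonal x₁ x₂ x₃ ++ side x₁ x₂) (begin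
      diagonal x₁ x₂ x₃ ++ side x₁ x₂ ++ side x₁ x₃ ++ side x₂ x₃  ↭⟨ Δ-triangle x₁ x₂ x₃ ⟨
      Δ (x₁ ∷ x₂ ∷ x₃ ∷ [])                                         ↭⟨ ΔX↭ΔY ⟩
      Δ (y₁ ∷ y₂ ∷ y₃ ∷ [])                                         ↭⟨ Δ-triangle y₁ y₂ y₃ ⟩
      diagonal y₁ y₂ y₃ ++ side y₁ y₂ ++ side y₁ y₃ ++ side y₂ y₃  ≡⟨ cong (_++ side y₁ y₃ ++ side y₂ y₃) same-prefix ⟩
      diagonal x₁ x₂ x₃ ++ side x₁ x₂ ++ side y₁ y₃ ++ side y₂ y₃  ∎)
    where
    open PermutationReasoning
    same-prefix : diagonal y₁ y₂ y₃ ++ side y₁ y₂ ≡ diagonal x₁ x₂ x₃ ++ side x₁ x₂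
    same-prefix = cong₂ _++_ (diagonal-constant y₁ y₂ y₃ x₁ x₂ x₃) (side-cong y₁ y₂ x₁ x₂ y₂-y₁≡x₂-x₁)

  affine-by-last-side₂₃ : ∀ x₁ x₂ x₃ y₁ y₂ y₃ → y₂ -ₘ y₁ ≡ x₂ -ₘ x₁ → y₃ -ₘ y₁ ≡ x₁ -ₘ x₃ →
                          side x₂ x₃ ↭ side y₂ y₃ → AffineImage (x₁ ∷ x₂ ∷ x₃ ∷ []) (y₁ ∷ y₂ ∷ y₃ ∷ [])
  affine-by-last-side₂₃ x₁ x₂ x₃ y₁ y₂ y₃ y₂-y₁≡x₂-x₁ y₃-y₁≡x₁-x₃ side₂₃↭ =
    by-y₂y₃ (∈-resp-↭ (↭-sym side₂₃↭) (there (here refl)))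
    where
    by-y₂y₃ : y₃ -ₘ y₂ ∈ side x₂ x₃ → AffineImage (x₁ ∷ x₂ ∷ x₃ ∷ []) (y₁ ∷ y₂ ∷ y₃ ∷ [])
    by-y₂y₃ (here y₃-y₂≡x₂-x₃) =
      affine-image Sign.- x₃ y₃ ( -ₘ-swap y₃ y₁ x₁ x₃ y₃-y₁≡x₁-x₃
                                ∷ -ₘ-swap y₃ y₂ x₂ x₃ y₃-y₂≡x₂-x₃
                                ∷ x-ₘx≡y-ₘy y₃ x₃ ∷ [])
    by-y₂y₃ (there (here y₃-y₂≡x₃-x₂)) =
      affine-image Sign.+ x₂ y₂ (-ₘ-swap y₂ y₁ x₂ x₁ y₂-y₁≡x₂-x₁ ∷ x-ₘx≡y-ₘy y₂ x₂ ∷ y₃-y₂≡x₃-x₂ ∷ [])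

  affine-by-last-side₁₃ : ∀ x₁ x₂ x₃ y₁ y₂ y₃ → y₂ -ₘ y₁ ≡ x₂ -ₘ x₁ → y₃ -ₘ y₁ ≡ x₃ -ₘ x₂ →
                          side x₁ x₃ ↭ side y₂ y₃ → AffineImage (x₁ ∷ x₂ ∷ x₃ ∷ []) (y₁ ∷ y₂ ∷ y₃ ∷ [])
  affine-by-last-side₁₃ x₁ x₂ x₃ y₁ y₂ y₃ y₂-y₁≡x₂-x₁ y₃-y₁≡x₃-x₂ side₁₃↭ =
    AffineImage-resp-↭ ↭-refl (swap y₂ y₁ ↭-refl)
      (by-y₂y₃ (∈-resp-↭ (↭-sym side₁₃↭) (there (here refl))))
    where
    by-y₂y₃ : y₃ -ₘ y₂ ∈ side x₁ x₃ → AffineImage (x₁ ∷ x₂ ∷ x₃ ∷ []) (y₂ ∷ y₁ ∷ y₃ ∷ [])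
    by-y₂y₃ (here y₃-y₂≡x₁-x₃) =
      affine-image Sign.- x₁ y₂ (x-ₘx≡y-ₘy y₂ x₁ ∷ -ₘ-swap y₂ y₁ x₂ x₁ y₂-y₁≡x₂-x₁ ∷ y₃-y₂≡x₁-x₃ ∷ [])
    by-y₂y₃ (there (here y₃-y₂≡x₃-x₁)) =
      affine-image Sign.+ x₃ y₃ ( -ₘ-swap y₃ y₂ x₃ x₁ y₃-y₂≡x₃-x₁
                                ∷ -ₘ-swap y₃ y₁ x₃ x₂ y₃-y₁≡x₃-x₂
                                ∷ x-ₘx≡y-ₘy y₃ x₃ ∷ [])

  aligned-triangle-affine : ∀ x₁ x₂ x₃ y₁ y₂ y₃ → y₂ -ₘ y₁ ≡ x₂ -ₘ x₁ →
                            Δ (x₁ ∷ x₂ ∷ x₃ ∷ []) ↭ Δ (y₁ ∷ y₂ ∷ y₃ ∷ []) →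
                            AffineImage (x₁ ∷ x₂ ∷ x₃ ∷ []) (y₁ ∷ y₂ ∷ y₃ ∷ [])
  aligned-triangle-affine x₁ x₂ x₃ y₁ y₂ y₃ y₂-y₁≡x₂-x₁ ΔX↭ΔY =
    locate-y₁y₃ (∈-resp-↭ (↭-sym sides) (there (here refl)))
    where
    sides : side x₁ x₃ ++ side x₂ x₃ ↭ side y₁ y₃ ++ side y₂ y₃
    sides = remaining-sides x₁ x₂ x₃ y₁ y₂ y₃ y₂-y₁≡x₂-x₁ ΔX↭ΔY

    locate-y₁y₃ : y₃ -ₘ y₁ ∈ side x₁ x₃ ++ side x₂ x₃ → AffineImage (x₁ ∷ x₂ ∷ x₃ ∷ []) (y₁ ∷ y₂ ∷ y₃ ∷ [])
    locate-y₁y₃ (here y₃-y₁≡x₁-x₃) =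
      affine-by-last-side₂₃ x₁ x₂ x₃ y₁ y₂ y₃ y₂-y₁≡x₂-x₁ y₃-y₁≡x₁-x₃ (++-cancel-↭
        (↭-trans (swap _ _ ↭-refl) (↭-reflexive (sym (side-cong y₁ y₃ x₃ x₁ y₃-y₁≡x₁-x₃)))) sides)
    locate-y₁y₃ (there (here y₃-y₁≡x₃-x₁)) =
      affine-image Sign.+ x₁ y₁ (x-ₘx≡y-ₘy y₁ x₁ ∷ y₂-y₁≡x₂-x₁ ∷ y₃-y₁≡x₃-x₁ ∷ [])
    locate-y₁y₃ (there (there (here y₃-y₁≡x₂-x₃))) =
      AffineImage-resp-↭ ↭-refl (swap y₂ y₁ ↭-refl)
        (affine-image Sign.- x₂ y₁ (y₂-y₁≡x₂-x₁ ∷ x-ₘx≡y-ₘy y₁ x₂ ∷ y₃-y₁≡x₂-x₃ ∷ []))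
    locate-y₁y₃ (there (there (there (here y₃-y₁≡x₃-x₂)))) =
      affine-by-last-side₁₃ x₁ x₂ x₃ y₁ y₂ y₃ y₂-y₁≡x₂-x₁ y₃-y₁≡x₃-x₂ (++-cancel-↭
        (↭-reflexive (sym (side-cong y₁ y₃ x₂ x₃ y₃-y₁≡x₃-x₂)))
        (↭-trans (++-comm (side x₂ x₃) (side x₁ x₃)) sides))

  triangle-affine : ∀ x₁ x₂ x₃ y₁ y₂ y₃ → y₁ ≢ y₂ →
                    Δ (x₁ ∷ x₂ ∷ x₃ ∷ []) ↭ Δ (y₁ ∷ y₂ ∷ y₃ ∷ []) →
                    AffineImage (x₁ ∷ x₂ ∷ x₃ ∷ []) (y₁ ∷ y₂ ∷ y₃ ∷ [])
  triangle-affine x₁ x₂ x₃ y₁ y₂ y₃ y₁≢y₂ ΔX↭ΔY =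
    locate-y₁y₂ (∈-resp-↭ (↭-sym ΔX↭ΔY) (there (there (there (here refl)))))
    where
    X = x₁ ∷ x₂ ∷ x₃ ∷ []
    Y = y₁ ∷ y₂ ∷ y₃ ∷ []

    aligned : ∀ a b c → a ∷ b ∷ c ∷ [] ↭ X → y₂ -ₘ y₁ ≡ b -ₘ a → AffineImage X Y
    aligned a b c abc↭X y₂-y₁≡b-a = AffineImage-resp-↭ abc↭X ↭-refl
      (aligned-triangle-affine a b c y₁ y₂ y₃ y₂-y₁≡b-a (↭-trans (Δ⁺ abc↭X) ΔX↭ΔY))

    off-diagonal : ∀ x → y₂ -ₘ y₁ ≢ x -ₘ x
    off-diagonal x y₂-y₁≡x-x = y₁≢y₂ (sym (x-ₘy≡z-ₘz⇒x≡y y₂ y₁ x y₂-y₁≡x-x))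

    -- Δ X lists the differences x_i - x_j with (i, j) in lexicographic order.
    locate-y₁y₂ : y₂ -ₘ y₁ ∈ Δ X → AffineImage X Y
    locate-y₁y₂ (here eq) = ⊥-elim (off-diagonal x₁ eq)
    locate-y₁y₂ (there (here eq)) = aligned x₂ x₁ x₃ (swap _ _ ↭-refl) eq
    locate-y₁y₂ (there (there (here eq))) =
      aligned x₃ x₁ x₂ (↭-trans (swap _ _ ↭-refl) (prep _ (swap _ _ ↭-refl))) eq
    locate-y₁y₂ (there (there (there (here eq)))) = aligned x₁ x₂ x₃ ↭-refl eq
    locate-y₁y₂ (there (there (there (there (here eq))))) = ⊥-elim (off-diagonal x₂ eq)
    locate-y₁y₂ (there (there (there (there (there (here eq)))))) = aligned x₃ x₂ x₁ (↭-reverse X) eq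
    locate-y₁y₂ (there (there (there (there (there (there (here eq))))))) =
      aligned x₁ x₃ x₂ (prep _ (swap _ _ ↭-refl)) eq
    locate-y₁y₂ (there (there (there (there (there (there (there (here eq)))))))) =
      aligned x₂ x₃ x₁ (↭-trans (prep _ (swap _ _ ↭-refl)) (swap _ _ ↭-refl)) eq
    locate-y₁y₂ (there (there (there (there (there (there (there (there (here eq))))))))) =
      ⊥-elim (off-diagonal x₃ eq)

proposition4p3 : (n : ℕ) .{{_ : NonZero n}} → (x₁ x₂ x₃ y₁ y₂ y₃ : Fin n) →
  x₁ ≢ x₂ → x₁ ≢ x₃ → x₂ ≢ x₃ →
  y₁ ≢ y₂ → y₁ ≢ y₃ → y₂ ≢ y₃ →
  Δ (x₁ ∷ x₂ ∷ x₃ ∷ []) ↭ Δ (y₁ ∷ y₂ ∷ y₃ ∷ []) →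
  Σ (Fin n) λ u → Σ (Fin n) λ v →
    (Σ (Fin n) λ w → u *ₘ w ≡ oneₘ) ×
    ((∀ z → z ∈ (y₁ ∷ y₂ ∷ y₃ ∷ []) → z ∈ map (λ x → u *ₘ x +ₘ v) (x₁ ∷ x₂ ∷ x₃ ∷ [])) ×
     (∀ z → z ∈ map (λ x → u *ₘ x +ₘ v) (x₁ ∷ x₂ ∷ x₃ ∷ []) → z ∈ (y₁ ∷ y₂ ∷ y₃ ∷ [])))
proposition4p3 n x₁ x₂ x₃ y₁ y₂ y₃ _ _ _ y₁≢y₂ _ _ ΔX↭ΔY =
  let u , v , u-isUnit , fX↭Y = triangle-affine x₁ x₂ x₃ y₁ y₂ y₃ y₁≢y₂ ΔX↭ΔY
  in u , v , u-isUnit , (λ _ → ∈-resp-↭ (↭-sym fX↭Y)) , (λ _ → ∈-resp-↭ fX↭Y)
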